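{- Let $\mathbf{R}^{\Rightarrow}$ be a finite coherent set of normality conditionals, and let $(\mathcal{E}_i)_{i\geq 0}$ be its LM-sequence. Then for every $i\geq 0$ such that $\mathcal{E}_i\neq\emptyset$, we have $\mathcal{E}_{i+1}\subsetneq\mathcal{E}_i$.
   Context: Formulas are built from propositional letters with the Boolean connectives; a normality conditional is a formula $A\Rightarrow B$ with $A,B$ Boolean, with body $b(A\Rightarrow B)=A$ and head $B$. $\models_{\mathrm{PL}}$ denotes classical propositional consequence. For $X\subseteq\mathbf{R}^{\Rightarrow}$, its materialization is $\mathrm{m}(X)=\{B\rightarrow C : B\Rightarrow C\in X\}$ ($\rightarrow$ material implication), and $\varepsilon(X)=\{A\Rightarrow B\in\mathbf{R}^{\Rightarrow} : \mathrm{m}(X)\models_{\mathrm{PL}}\neg A\}$. The LM-sequence is defined by $\mathcal{E}_0=\mathbf{R}^{\Rightarrow}$ and $\mathcal{E}_i=\varepsilon(\mathcal{E}_{i-1})$ for $i\geq 1$. $\mathbf{R}^{\Rightarrow}$ is coherent if there is no nonempty $X\subseteq\mathbf{R}^{\Rightarrow}$ with $\mathrm{m}(X)\models_{\mathrm{PL}}\bigwedge_{r\in X}\neg b(r)$ (standing assumption of the paper). -}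

module Defs where

open import Data.Nat using (ℕ; zero; suc)
open import Data.Bool using (Bool; true; false; not; _∧_; _∨_)
open import Data.List using (List)
open import Data.List.Membership.Propositional using (_∈_)
open import Data.Product using (_×_; ∃)
open import Data.Empty using (⊥)
open import Relation.Binary.PropositionalEquality using (_≡_)
open import Relation.Nullary using (¬_)

data Form : Set where
  atom : ℕ → Form
  ⊤f ⊥f : Form
  ¬f_ : Form → Form
  _∧f_ _∨f_ _→f_ : Form → Form → Form

Valuation : Set
Valuation = ℕ → Bool

⟦_⟧ : Form → Valuation → Bool
⟦ atom p ⟧ v = v p
⟦ ⊤f ⟧ v = true
⟦ ⊥f ⟧ v = false
⟦ ¬f A ⟧ v = not (⟦ A ⟧ v)
⟦ A ∧f B ⟧ v = ⟦ A ⟧ v ∧ ⟦ B ⟧ v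
⟦ A ∨f B ⟧ v = ⟦ A ⟧ v ∨ ⟦ B ⟧ v
⟦ A →f B ⟧ v = not (⟦ A ⟧ v) ∨ ⟦ B ⟧ v

_⊩_ : Valuation → Form → Set
v ⊩ A = ⟦ A ⟧ v ≡ true

FSet : Set₁
FSet = Form → Set

_⊨PL_ : FSet → Form → Set
Γ ⊨PL A = ∀ (v : Valuation) → (∀ φ → Γ φ → v ⊩ φ) → v ⊩ A

record Cond : Set where
  constructor _⇒_
  field
    body : Form
    head : Form
open Cond public

CSet : Set₁
CSet = Cond → Set

_⊆_ : CSet → CSet → Set
X ⊆ Y = ∀ c → X c → Y c

m : CSet → FSet
m X φ = ∃ λ c → X c × (φ ≡ (body c →f head c))

elems : List Cond → CSet
elems R c = c ∈ R

ε : List Cond → CSet → CSet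
ε R X c = (c ∈ R) × (m X ⊨PL (¬f body c))

LM : List Cond → ℕ → CSet
LM R zero = elems R
LM R (suc i) = ε R (LM R i)

-- m(X) ⊨PL ⋀_{r ∈ X} ¬ b(r), stated semantically (X ⊆ R finite)
_⊨⋀¬b_ : FSet → CSet → Set
Γ ⊨⋀¬b X = ∀ (v : Valuation) → (∀ φ → Γ φ → v ⊩ φ) → ∀ r → X r → v ⊩ (¬f body r)

Coherent : List Cond → Set₁
Coherent R = ¬ (∃ λ (X : CSet) → (X ⊆ elems R) × (∃ λ c → X c) × (m X ⊨⋀¬b X))

_⊂_ : CSet → CSet → Set
X ⊂ Y = (X ⊆ Y) × (∃ λ c → Y c × ¬ X c)

{-# OPTIONS --safe #-}
-- E_{i+1} ⊆ E_i because ε is monotone. If the inclusion were not strict, X = E_i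
-- would be a nonempty subset of R⇒ with m(X) ⊨ ¬b(r) for every r ∈ X, contradicting
-- coherence. To exhibit an element of E_i ∖ E_{i+1} constructively, membership in
-- each E_i must be decidable: the formulas involved mention only letters below a
-- fixed bound, so quantifying over all valuations reduces to finitely many cases.
module Submission where

open import Defs
open import Data.Nat using (ℕ; zero; suc; _≤_; _<_; _⊔_; s≤s)
open import Data.Nat.Properties using (m⊔n≤o⇒m≤o; m⊔n≤o⇒n≤o; ≤-totalOrder)
open import Data.Bool using (Bool; true; false; not; _∧_; _∨_)
open import Data.Bool.Properties using (_≟_)
open import Data.List using (List; []; _∷_; map)
open import Data.List.Extrema ≤-totalOrder using (max; xs≤max)
open import Data.List.Membership.Propositional using (_∈_)
open import Data.List.Membership.Propositional.Properties using (∈-map⁺)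
open import Data.List.Relation.Unary.All as All using ()
open import Data.List.Relation.Unary.Any using (here; there)
open import Data.Product using (∃; _×_; _,_; proj₂)
open import Data.Sum using (_⊎_; inj₁; inj₂)
open import Function using (_∘_; const)
open import Relation.Nullary using (¬_; Dec; yes; no; contradiction)
open import Relation.Nullary.Decidable using (map′; toSum; _×-dec_; _→-dec_)
open import Relation.Binary.PropositionalEquality using (_≡_; refl; sym; trans; cong; cong₂)

atomBound : Form → ℕ
atomBound (atom p) = suc p
atomBound ⊤f = 0
atomBound ⊥f = 0
atomBound (¬f A) = atomBound A
atomBound (A ∧f B) = atomBound A ⊔ atomBound B
atomBound (A ∨f B) = atomBound A ⊔ atomBound B
atomBound (A →f B) = atomBound A ⊔ atomBound B

AgreeBelow : ℕ → Valuation → Valuation → Set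
AgreeBelow n v w = ∀ p → p < n → v p ≡ w p

agreeBelow-sym : ∀ {n v w} → AgreeBelow n v w → AgreeBelow n w v
agreeBelow-sym agree p p<n = sym (agree p p<n)

⟦⟧-local : ∀ A {n v w} → atomBound A ≤ n → AgreeBelow n v w → ⟦ A ⟧ v ≡ ⟦ A ⟧ w
⟦⟧-local (atom p) bound agree = agree p bound
⟦⟧-local ⊤f bound agree = refl
⟦⟧-local ⊥f bound agree = refl
⟦⟧-local (¬f A) bound agree = cong not (⟦⟧-local A bound agree)
⟦⟧-local (A ∧f B) bound agree =
  cong₂ _∧_ (⟦⟧-local A (m⊔n≤o⇒m≤o _ _ bound) agree) (⟦⟧-local B (m⊔n≤o⇒n≤o _ _ bound) agree)
⟦⟧-local (A ∨f B) bound agree =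
  cong₂ _∨_ (⟦⟧-local A (m⊔n≤o⇒m≤o _ _ bound) agree) (⟦⟧-local B (m⊔n≤o⇒n≤o _ _ bound) agree)
⟦⟧-local (A →f B) bound agree =
  cong₂ (λ a b → not a ∨ b) (⟦⟧-local A (m⊔n≤o⇒m≤o _ _ bound) agree) (⟦⟧-local B (m⊔n≤o⇒n≤o _ _ bound) agree)

⊩-local : ∀ A {n v w} → atomBound A ≤ n → AgreeBelow n v w → v ⊩ A → w ⊩ A
⊩-local A bound agree v⊩A = trans (sym (⟦⟧-local A bound agree)) v⊩A

_⊩*_ : Valuation → FSet → Set
v ⊩* Γ = ∀ φ → Γ φ → v ⊩ φ

BoundedBy : ℕ → FSet → Set
BoundedBy n Γ = ∀ φ → Γ φ → atomBound φ ≤ n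

⊩*-local : ∀ {n Γ v w} → BoundedBy n Γ → AgreeBelow n v w → v ⊩* Γ → w ⊩* Γ
⊩*-local bounded agree v⊩Γ φ φ∈Γ = ⊩-local φ (bounded φ φ∈Γ) agree (v⊩Γ φ φ∈Γ)

LocalBelow : ℕ → (Valuation → Set) → Set
LocalBelow n P = ∀ {v w} → AgreeBelow n v w → P v → P w

infixr 5 _∷ᵥ_

_∷ᵥ_ : Bool → Valuation → Valuation
(b ∷ᵥ v) zero = b
(b ∷ᵥ v) (suc p) = v p

∷ᵥ-agreeBelow : ∀ b {n v w} → AgreeBelow n v w → AgreeBelow (suc n) (b ∷ᵥ v) (b ∷ᵥ w)
∷ᵥ-agreeBelow b agree zero _ = refl
∷ᵥ-agreeBelow b agree (suc p) (s≤s p<n) = agree p p<n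

∷ᵥ-η : ∀ {n} v → AgreeBelow n (v 0 ∷ᵥ v ∘ suc) v
∷ᵥ-η v zero _ = refl
∷ᵥ-η v (suc p) _ = refl

∀-valuation? : ∀ n {P : Valuation → Set} → LocalBelow n P → (∀ v → Dec (P v)) →
               Dec (∀ v → P v)
∀-valuation? zero local P? = map′ (λ p v → local (λ _ ()) p) (λ all → all (const false)) (P? (const false))
∀-valuation? (suc n) {P} local P? =
  map′ join (λ all → (all ∘ (true ∷ᵥ_)) , (all ∘ (false ∷ᵥ_))) (fixing true ×-dec fixing false)
  where
  fixing : ∀ b → Dec (∀ v → P (b ∷ᵥ v))
  fixing b = ∀-valuation? n (local ∘ ∷ᵥ-agreeBelow b) (P? ∘ (b ∷ᵥ_))

  join : (∀ v → P (true ∷ᵥ v)) × (∀ v → P (false ∷ᵥ v)) → ∀ v → P v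
  join (onTrue , onFalse) v = local (∷ᵥ-η v) (either (v 0) (v ∘ suc))
    where
    either : ∀ b v′ → P (b ∷ᵥ v′)
    either true = onTrue
    either false = onFalse

⊨PL? : ∀ {n Γ A} → BoundedBy n Γ → atomBound A ≤ n → (∀ v → Dec (v ⊩* Γ)) → Dec (Γ ⊨PL A)
⊨PL? {n} {Γ} {A} bounded bound ⊩Γ? = ∀-valuation? n local (λ v → ⊩Γ? v →-dec (⟦ A ⟧ v ≟ true))
  where
  local : LocalBelow n (λ v → v ⊩* Γ → v ⊩ A)
  local agree entails w⊩Γ = ⊩-local A bound agree (entails (⊩*-local bounded (agreeBelow-sym agree) w⊩Γ))

module _ {A : Set} where

  all∈⊎any∈ : {P Q : A → Set} (xs : List A) → (∀ x → x ∈ xs → P x ⊎ Q x) →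
              (∀ x → x ∈ xs → P x) ⊎ (∃ λ x → x ∈ xs × Q x)
  all∈⊎any∈ [] _ = inj₁ λ _ ()
  all∈⊎any∈ (x ∷ xs) P⊎Q with P⊎Q x (here refl) | all∈⊎any∈ xs (λ y → P⊎Q y ∘ there)
  ... | inj₂ Qx | _ = inj₂ (x , here refl , Qx)
  ... | inj₁ _ | inj₂ (y , y∈xs , Qy) = inj₂ (y , there y∈xs , Qy)
  ... | inj₁ Px | inj₁ allP = inj₁ λ { _ (here refl) → Px ; y (there y∈xs) → allP y y∈xs }

  DecidableOn : List A → (A → Set) → Set
  DecidableOn xs P = ∀ x → x ∈ xs → Dec (P x)

  all∈? : {P : A → Set} (xs : List A) → DecidableOn xs P → Dec (∀ x → x ∈ xs → P x)
  all∈? xs P? with all∈⊎any∈ xs (λ x → toSum ∘ P? x)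
  ... | inj₁ allP = yes allP
  ... | inj₂ (x , x∈xs , ¬Px) = no λ allP → ¬Px (allP x x∈xs)

condsBound : List Cond → ℕ
condsBound R = max 0 (map (λ c → atomBound (body c →f head c)) R)

condsBound-∈ : ∀ {c} R → c ∈ R → atomBound (body c →f head c) ≤ condsBound R
condsBound-∈ R c∈R = All.lookup (xs≤max 0 _) (∈-map⁺ _ c∈R)

m-boundedBy : ∀ {R X} → X ⊆ elems R → BoundedBy (condsBound R) (m X)
m-boundedBy {R} X⊆R _ (c , c∈X , refl) = condsBound-∈ R (X⊆R c c∈X)

⊩*m? : ∀ {R X} → X ⊆ elems R → DecidableOn R X → ∀ v → Dec (v ⊩* m X)
⊩*m? {R} {X} X⊆R X? v =
  map′ (λ sat → λ { _ (c , c∈X , refl) → sat c (X⊆R c c∈X) c∈X })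
       (λ v⊩mX c _ c∈X → v⊩mX _ (c , c∈X , refl))
       (all∈? R λ c c∈R → X? c c∈R →-dec (⟦ body c →f head c ⟧ v ≟ true))

ε-decidableOn : ∀ {R X} → X ⊆ elems R → DecidableOn R X → DecidableOn R (ε R X)
ε-decidableOn {R} X⊆R X? c c∈R =
  map′ (c∈R ,_) proj₂
       (⊨PL? {A = ¬f body c} (m-boundedBy X⊆R) (m⊔n≤o⇒m≤o _ _ (condsBound-∈ R c∈R)) (⊩*m? X⊆R X?))

ε-mono : ∀ {R X Y} → X ⊆ Y → ε R X ⊆ ε R Y
ε-mono X⊆Y c (c∈R , mX⊨¬b) =
  c∈R , λ v v⊩mY → mX⊨¬b v λ { _ (d , d∈X , refl) → v⊩mY _ (d , X⊆Y d d∈X , refl) }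

LM-⊆ : ∀ R i → LM R i ⊆ elems R
LM-⊆ R zero c c∈R = c∈R
LM-⊆ R (suc i) c (c∈R , _) = c∈R

LM-decidableOn : ∀ R i → DecidableOn R (LM R i)
LM-decidableOn R zero c c∈R = yes c∈R
LM-decidableOn R (suc i) = ε-decidableOn (LM-⊆ R i) (LM-decidableOn R i)

LM-antitone : ∀ R i → LM R (suc i) ⊆ LM R i
LM-antitone R zero c (c∈R , _) = c∈R
LM-antitone R (suc i) = ε-mono (LM-antitone R i)

coherent⇒¬⊆ε : ∀ {R X} → Coherent R → X ⊆ elems R → ∃ X → ¬ (X ⊆ ε R X)
coherent⇒¬⊆ε {X = X} coherent X⊆R nonempty X⊆εX =
  coherent (X , X⊆R , nonempty , λ v v⊩mX r r∈X → proj₂ (X⊆εX r r∈X) v v⊩mX)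

fact1 : (R : List Cond) → Coherent R → (i : ℕ) →
    (∃ λ c → LM R i c) → LM R (suc i) ⊂ LM R i
fact1 R coherent i nonempty with all∈⊎any∈ R shrinks?
  where
  shrinks? : ∀ c → c ∈ R → (LM R i c → LM R (suc i) c) ⊎ (LM R i c × ¬ LM R (suc i) c)
  shrinks? c c∈R with LM-decidableOn R i c c∈R | LM-decidableOn R (suc i) c c∈R
  ... | yes inᵢ | no ∉ᵢ₊₁ = inj₂ (inᵢ , ∉ᵢ₊₁)
  ... | yes _ | yes inᵢ₊₁ = inj₁ (const inᵢ₊₁)
  ... | no ∉ᵢ | _ = inj₁ (λ inᵢ → contradiction inᵢ ∉ᵢ)
... | inj₂ (c , _ , witness) = LM-antitone R i , c , witness
... | inj₁ stable = contradiction (λ c inᵢ → stable c (LM-⊆ R i c inᵢ) inᵢ)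
                                  (coherent⇒¬⊆ε coherent (LM-⊆ R i) nonempty)
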